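{- Let $k\ge1$, let $G=(V,E)$ be a graph and let $T$ be any $2k$-Steiner root of $G$. Then for any two distinct maximal cliques $K_i,K_j$ of $G$, $\mathcal{C}(T\langle K_i\rangle)\cap\mathcal{C}(T\langle K_j\rangle)=\emptyset$.
   Context: A $2k$-Steiner root of $G$ is a tree $T$ with $V\subseteq V(T)$ such that for distinct $u,v\in V$, $uv\in E$ iff $\mathrm{dist}_T(u,v)\le 2k$. $T\langle X\rangle$ is the smallest subtree of $T$ containing $X$, and $\mathcal{C}(T')$ is the center (set of minimum-eccentricity nodes) of a tree $T'$. -}

module Defs where

open import Data.Nat using (ℕ; zero; suc; _≤_; _*_)
open import Data.Fin using (Fin)
open import Data.List using (List; []; _∷_; _++_; length)
open import Data.List.Relation.Unary.Linked using (Linked)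
open import Data.List.Relation.Unary.Unique.Propositional using (Unique)
open import Data.Product using (Σ; ∃; _×_; _,_)
open import Relation.Binary.PropositionalEquality using (_≡_; _≢_)
open import Relation.Nullary using (¬_)
open import Function.Bundles using (_⇔_)
open import Function.Definitions using (Injective)

record Graph (n : ℕ) : Set₁ where
  field
    Adj    : Fin n → Fin n → Set
    sym    : ∀ {u v} → Adj u v → Adj v u
    irrefl : ∀ {u} → ¬ Adj u u

data Walk {m : ℕ} (A : Fin m → Fin m → Set) : Fin m → Fin m → ℕ → Set where
  here : ∀ {u} → Walk A u u zero
  step : ∀ {u w v l} → A u w → Walk A w v l → Walk A u v (suc l)

DistLe : {m : ℕ} → (Fin m → Fin m → Set) → Fin m → Fin m → ℕ → Set
DistLe A u v d = Σ ℕ λ l → l ≤ d × Walk A u v l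

HasCycle : {m : ℕ} → (Fin m → Fin m → Set) → Set
HasCycle {m} A = Σ (Fin m) λ x → Σ (List (Fin m)) λ ys →
  (2 ≤ length ys) × Unique (x ∷ ys) × Linked A (x ∷ ys ++ x ∷ [])

Connected : {m : ℕ} → (Fin m → Fin m → Set) → Set
Connected {m} A = ∀ (u v : Fin m) → Σ ℕ λ l → Walk A u v l

record Tree (m : ℕ) : Set₁ where
  field
    graph     : Graph m
  open Graph graph public
  field
    connected : Connected Adj
    acyclic   : ¬ HasCycle Adj

-- T is a 2k-Steiner root of G, with V ⊆ V(T) given by the injection ι.
IsSteinerRoot : {n m : ℕ} → ℕ → Graph n → Tree m → (Fin n → Fin m) → Set
IsSteinerRoot {n} k G T ι =
  Injective _≡_ _≡_ ι ×
  (∀ (u v : Fin n) → u ≢ v → (Graph.Adj G u v ⇔ DistLe (Tree.Adj T) (ι u) (ι v) (2 * k)))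

IsClique : {n : ℕ} → Graph n → (Fin n → Set) → Set
IsClique {n} G K = ∀ (u v : Fin n) → K u → K v → u ≢ v → Graph.Adj G u v

IsMaximalClique : {n : ℕ} → Graph n → (Fin n → Set) → Set₁
IsMaximalClique {n} G K = IsClique G K ×
  (∀ (K' : Fin n → Set) → IsClique G K' → (∀ x → K x → K' x) → ∀ x → K' x → K x)

Induced : {m : ℕ} → (Fin m → Fin m → Set) → (Fin m → Set) → Fin m → Fin m → Set
Induced A S x y = S x × S y × A x y

IsSubtreeContaining : {n m : ℕ} → Tree m → (Fin n → Fin m) → (Fin n → Set) → (Fin m → Set) → Set
IsSubtreeContaining {n} {m} T ι K S =
  (∀ x → K x → S (ι x)) ×
  (∀ (a b : Fin m) → S a → S b → Σ ℕ λ l → Walk (Induced (Tree.Adj T) S) a b l)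

IsSteinerSubtree : {n m : ℕ} → Tree m → (Fin n → Fin m) → (Fin n → Set) → (Fin m → Set) → Set₁
IsSteinerSubtree {n} {m} T ι K S =
  IsSubtreeContaining T ι K S ×
  (∀ (S' : Fin m → Set) → IsSubtreeContaining T ι K S' → ∀ a → S a → S' a)

EccLe : {m : ℕ} → Tree m → (Fin m → Set) → Fin m → ℕ → Set
EccLe {m} T S c e = ∀ (v : Fin m) → S v → DistLe (Induced (Tree.Adj T) S) c v e

InCenter : {m : ℕ} → Tree m → (Fin m → Set) → Fin m → Set
InCenter {m} T S c = S c × (∀ (c' : Fin m) → S c' → ∀ (e : ℕ) → EccLe T S c' e → EccLe T S c e)

module Submission where

-- Let S be the Steiner subtree T⟨K⟩ of a clique K.  Clique members are at
-- tree distance ≤ 2k, and subtrees of a tree are isometric, so the images of K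
-- have pairwise distance ≤ 2k inside T[S].  In a tree a finite set of diameter
-- ≤ 2k has a point within distance k of all of it (walk from any point towards
-- each new target until within k of it; the tree structure keeps the earlier
-- targets within k).  The ball of radius k around that point is itself a subtree
-- containing K, hence contains S; so T[S] has radius ≤ k and every centre c has
-- eccentricity ≤ k.  If c were a centre of both T⟨Ki⟩ and T⟨Kj⟩, every u ∈ Ki and
-- v ∈ Kj would be within k + k of each other through c, so Ki ∪ Kj would be a
-- clique and maximality would force Ki = Kj.

open import Defs
open import Data.Nat using (ℕ; zero; suc; _+_; _*_; _≤_; _<_; z≤n; s≤s; _≤?_)
open import Data.Nat.Properties
open import Data.Nat.Induction using (<-rec)
open import Data.Fin using (Fin) renaming (zero to fzero; suc to fsuc)
open import Data.Fin.Properties using (any?) renaming (_≟_ to _≟ᶠ_)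
open import Data.List using (List; []; _∷_; _++_; map; filter; allFin)
open import Data.List.Relation.Unary.Linked as Linked using (Linked; [-]; _∷_)
open import Data.List.Relation.Unary.All using ([]; _∷_)
open import Data.List.Relation.Unary.All.Properties using (¬Any⇒All¬)
open import Data.List.Relation.Unary.Any using (here; there)
open import Data.List.Relation.Unary.Unique.Propositional using (Unique)
open import Data.List.Relation.Unary.AllPairs using ([]; _∷_)
open import Data.List.Membership.Propositional using (_∈_; _∉_)
open import Data.List.Membership.Propositional.Properties
  using (∈-allFin; ∈-map∘filter⁺; ∈-map∘filter⁻)
import Data.List.Membership.DecPropositional as DecMembership
open import Data.Product using (Σ; _×_; _,_; proj₁; proj₂)
open import Data.Sum using (_⊎_; inj₁; inj₂)
open import Data.Empty using (⊥; ⊥-elim)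
open import Relation.Nullary using (¬_; Dec; yes; no)
open import Relation.Nullary.Decidable using (_×-dec_; _⊎-dec_; ¬¬-excluded-middle)
open import Relation.Binary.PropositionalEquality using (_≡_; _≢_; refl; sym; cong; subst)
open import Function.Bundles using (_⇔_; mk⇔; Equivalence)

NodeRel : ℕ → Set₁
NodeRel m = Fin m → Fin m → Set

module _ {m : ℕ} {R : NodeRel m} where

  infixr 5 _++ʷ_
  infixl 5 _▷_

  _++ʷ_ : ∀ {a b c l₁ l₂} → Walk R a b l₁ → Walk R b c l₂ → Walk R a c (l₁ + l₂)
  here ++ʷ w = w
  step r w₁ ++ʷ w₂ = step r (w₁ ++ʷ w₂)

  _▷_ : ∀ {a b c l} → Walk R a b l → R b c → Walk R a c (suc l)
  _▷_ {l = l} w r = subst (Walk R _ _) (+-comm l 1) (w ++ʷ step r here)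

  reverseʷ : (∀ {x y} → R x y → R y x) → ∀ {a b l} → Walk R a b l → Walk R b a l
  reverseʷ symR here = here
  reverseʷ symR (step r w) = reverseʷ symR w ▷ symR r

mapʷ : ∀ {m} {R R' : NodeRel m} → (∀ {x y} → R x y → R' x y) →
  ∀ {a b l} → Walk R a b l → Walk R' a b l
mapʷ f here = here
mapʷ f (step r w) = step (f r) (mapʷ f w)

meet : ∀ {m} {R : NodeRel m} → (∀ {x y} → R x y → R y x) →
  ∀ {c a b d₁ d₂} → DistLe R c a d₁ → DistLe R c b d₂ → DistLe R a b (d₁ + d₂)
meet symR (l₁ , l₁≤ , ca) (l₂ , l₂≤ , cb) = l₁ + l₂ , +-mono-≤ l₁≤ l₂≤ , reverseʷ symR ca ++ʷ cb

forget-induced : ∀ {m} {R : NodeRel m} {S a b d} → DistLe (Induced R S) a b d → DistLe R a b d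
forget-induced (l , l≤ , w) = l , l≤ , mapʷ (λ r → proj₂ (proj₂ r)) w

Induced-sym : ∀ {m} {R : NodeRel m} {S} → (∀ {x y} → R x y → R y x) →
  ∀ {x y} → Induced R S x y → Induced R S y x
Induced-sym symR (sx , sy , r) = sy , sx , symR r

Avoiding : ∀ {m} → NodeRel m → Fin m → NodeRel m
Avoiding R z p q = R p q × p ≢ z × q ≢ z

Avoiding-sym : ∀ {m} {R : NodeRel m} {z} → (∀ {x y} → R x y → R y x) →
  ∀ {x y} → Avoiding R z x y → Avoiding R z y x
Avoiding-sym symR (r , x≢z , y≢z) = symR r , y≢z , x≢z

avoids-or-visits : ∀ {m} {R : NodeRel m} z {a b l} → Walk R a b l →
  (a ≢ z × Walk (Avoiding R z) a b l) ⊎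
  (Σ ℕ λ l₁ → Σ ℕ λ l₂ → l₁ + l₂ ≡ l × Walk R a z l₁ × Walk R z b l₂)
avoids-or-visits z {a} w with a ≟ᶠ z
... | yes refl = inj₂ (0 , _ , refl , here , w)
avoids-or-visits z here | no a≢z = inj₁ (a≢z , here)
avoids-or-visits z (step r w) | no a≢z with avoids-or-visits z w
... | inj₁ (q≢z , w') = inj₁ (a≢z , step (r , a≢z , q≢z) w')
... | inj₂ (l₁ , l₂ , e , w₁ , w₂) = inj₂ (suc l₁ , l₂ , cong suc e , step r w₁ , w₂)

WithoutEdge : ∀ {m} → NodeRel m → Fin m → Fin m → NodeRel m
WithoutEdge R x y p q = R p q × ¬ (p ≡ x × q ≡ y) × ¬ (p ≡ y × q ≡ x)

NoBypass : ∀ {m} → NodeRel m → Set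
NoBypass R = ∀ {x y l} → R x y → ¬ Walk (WithoutEdge R x y) y x l

SimplePath : ∀ {m} → NodeRel m → Fin m → Fin m → Set
SimplePath {m} R p x =
  Σ (List (Fin m)) λ ys → Unique (p ∷ ys) × x ∉ p ∷ ys × Linked R (p ∷ ys ++ x ∷ [])

module _ {m : ℕ} {R : NodeRel m} where

  open DecMembership (_≟ᶠ_ {m}) using (_∈?_)

  cut-at : ∀ {p x} (zs : List (Fin m)) → p ∈ zs → Unique zs → x ∉ zs →
    Linked R (zs ++ x ∷ []) → SimplePath R p x
  cut-at (_ ∷ zs) (here refl) unique x∉ linked = zs , unique , x∉ , linked
  cut-at (_ ∷ zs) (there p∈) (_ ∷ unique) x∉ linked =
    cut-at zs p∈ unique (λ x∈ → x∉ (there x∈)) (Linked.tail linked)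

  -- Every walk from p to x is trivial (p ≡ x) or contains a simple path from p to x:
  -- prepend p to the simple path of the rest, cutting off a loop if p reappears.
  simplify : ∀ {p x l} → Walk R p x l → p ≡ x ⊎ SimplePath R p x
  simplify {p} {x} w with p ≟ᶠ x
  ... | yes p≡x = inj₁ p≡x
  simplify here | no p≢x = ⊥-elim (p≢x refl)
  simplify {p} {x} (step {w = q} r w) | no p≢x with simplify w
  ... | inj₁ refl = inj₂ ([] , [] ∷ [] , x∉[p] , r ∷ [-])
    where
    x∉[p] : x ∉ p ∷ []
    x∉[p] (here x≡p) = p≢x (sym x≡p)
  ... | inj₂ (ys , unique , x∉ , linked) with p ∈? q ∷ ys
  ...   | yes p∈ = inj₂ (cut-at (q ∷ ys) p∈ unique x∉ linked)
  ...   | no p∉ = inj₂ (q ∷ ys , ¬Any⇒All¬ _ p∉ ∷ unique , x∉p∷ , r ∷ linked)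
    where
    x∉p∷ : x ∉ p ∷ q ∷ ys
    x∉p∷ (here x≡p) = p≢x (sym x≡p)
    x∉p∷ (there x∈) = x∉ x∈

-- In a tree a bypass of the edge x–y would close a cycle through x and y.
trees-have-no-bypass : ∀ {m} (T : Tree m) → NoBypass (Tree.Adj T)
trees-have-no-bypass T {x} {y} xy w with simplify w
... | inj₁ y≡x = Tree.irrefl T (subst (Tree.Adj T x) y≡x xy)
... | inj₂ ([] , _ , _ , yx ∷ [-]) = proj₂ (proj₂ yx) (refl , refl)
... | inj₂ (z ∷ zs , unique , x∉ , linked) = Tree.acyclic T
  (x , y ∷ z ∷ zs , s≤s (s≤s z≤n) , ¬Any⇒All¬ _ x∉ ∷ unique , xy ∷ Linked.map proj₁ linked)

no-bypass-⊆ : ∀ {m} {R R' : NodeRel m} → (∀ {p q} → R' p q → R p q) → NoBypass R → NoBypass R'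
no-bypass-⊆ R'⊆R noBypass r w = noBypass (R'⊆R r) (mapʷ (λ { (r' , ne) → R'⊆R r' , ne }) w)

no-detour : ∀ {m} {R : NodeRel m} → NoBypass R → ∀ {x y z l₁ l₂} → R x y →
  Walk (Avoiding R x) y z l₁ → Walk (Avoiding R y) z x l₂ → ⊥
no-detour {R = R} noBypass r w₁ w₂ = noBypass r (mapʷ avoids-x w₁ ++ʷ mapʷ avoids-y w₂)
  where
  avoids-x : ∀ {x y p q} → Avoiding R x p q → WithoutEdge R x y p q
  avoids-x (r , p≢x , q≢x) = r , (λ e → p≢x (proj₁ e)) , (λ e → q≢x (proj₂ e))
  avoids-y : ∀ {x y p q} → Avoiding R y p q → WithoutEdge R x y p q
  avoids-y (r , p≢y , q≢y) = r , (λ e → q≢y (proj₂ e)) , (λ e → p≢y (proj₁ e))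

Shortest : ∀ {m} → NodeRel m → Fin m → Fin m → ℕ → Set
Shortest R a b l = ∀ {l'} → Walk R a b l' → l ≤ l'

shortest-tail : ∀ {m} {R : NodeRel m} {a q b l} → R a q → Shortest R a b (suc l) → Shortest R q b l
shortest-tail r shortest w = ≤-pred (shortest (step r w))

tail-avoids-head : ∀ {m} {R : NodeRel m} {a q b l} →
  Shortest R a b (suc l) → Walk R q b l → Walk (Avoiding R a) q b l
tail-avoids-head {a = a} shortest w with avoids-or-visits a w
... | inj₁ (_ , w') = w'
... | inj₂ (l₁ , l₂ , refl , _ , ab) = ⊥-elim (<-irrefl refl (≤-trans (shortest ab) (m≤n+m l₂ l₁)))

module _ {m : ℕ} {R : NodeRel m} (R? : ∀ a b → Dec (R a b)) where

  walk? : ∀ l a b → Dec (Walk R a b l)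
  walk? zero a b with a ≟ᶠ b
  ... | yes refl = yes here
  ... | no a≢b = no λ { here → a≢b refl }
  walk? (suc l) a b with any? (λ c → R? a c ×-dec walk? l c b)
  ... | yes (c , r , w) = yes (step r w)
  ... | no none = no λ { (step r w) → none (_ , r , w) }

  shorter? : ∀ l a b → Dec (Σ ℕ λ l' → l' < l × Walk R a b l')
  shorter? zero a b = no λ { (_ , () , _) }
  shorter? (suc l) a b with walk? l a b ⊎-dec shorter? l a b
  ... | yes (inj₁ w) = yes (l , ≤-refl , w)
  ... | yes (inj₂ (l' , l'<l , w)) = yes (l' , m≤n⇒m≤1+n l'<l , w)
  ... | no none = no λ { (l' , s≤s l'≤l , w) → none (shortcut l' l'≤l w) }
    where
    shortcut : ∀ l' → l' ≤ l → Walk R a b l' → Walk R a b l ⊎ (Σ ℕ λ l'' → l'' < l × Walk R a b l'')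
    shortcut l' l'≤l w with m≤n⇒m<n∨m≡n l'≤l
    ... | inj₁ l'<l = inj₂ (l' , l'<l , w)
    ... | inj₂ refl = inj₁ w

  shortest : ∀ {a b l} → Walk R a b l → Σ ℕ λ l₀ → l₀ ≤ l × Walk R a b l₀ × Shortest R a b l₀
  shortest {a} {b} {l} = <-rec P descend l
    where
    P : ℕ → Set
    P l = Walk R a b l → Σ ℕ λ l₀ → l₀ ≤ l × Walk R a b l₀ × Shortest R a b l₀
    descend : ∀ l → (∀ {l'} → l' < l → P l') → P l
    descend l rec w with shorter? l a b
    ... | yes (l' , l'<l , w') with rec l'<l w'
    ...   | l₀ , l₀≤l' , geodesic = l₀ , ≤-trans l₀≤l' (<⇒≤ l'<l) , geodesic
    descend l rec w | no none = l , ≤-refl , w , λ {l'} w' → ≮⇒≥ (λ l'<l → none (l' , l'<l , w'))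

InducesConnected : ∀ {m} → NodeRel m → (Fin m → Set) → Set
InducesConnected R S = ∀ a b → S a → S b → Σ ℕ (Walk (Induced R S) a b)

module _ {m : ℕ} {R : NodeRel m} (noBypass : NoBypass R)
         {S : Fin m → Set} (S? : ∀ a → Dec (S a)) (connected : InducesConnected R S) where

  -- A shortest walk between two nodes of S stays inside S: leaving S at an edge a–q
  -- and coming back from b to a through S would be a detour around that edge.
  shortest-stays-inside : ∀ {a b l} → S a → S b → (w : Walk R a b l) → Shortest R a b l →
    Walk (Induced R S) a b l
  shortest-stays-inside sa sb here _ = here
  shortest-stays-inside {a} {b} sa sb (step {w = q} r rest) short with S? q
  ... | yes sq = step (sa , sq , r) (shortest-stays-inside sq sb rest (shortest-tail r short))
  ... | no q∉S = ⊥-elim (no-detour noBypass r (tail-avoids-head short rest)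
                           (mapʷ avoids-q (proj₂ (connected b a sb sa))))
    where
    avoids-q : ∀ {p p'} → Induced R S p p' → Avoiding R q p p'
    avoids-q (sp , sp' , r') =
      r' , (λ p≡q → q∉S (subst S p≡q sp)) , (λ p'≡q → q∉S (subst S p'≡q sp'))

  induced-distance : (∀ a b → Dec (R a b)) →
    ∀ {a b d} → S a → S b → DistLe R a b d → DistLe (Induced R S) a b d
  induced-distance R? sa sb (l , l≤d , w) with shortest R? w
  ... | l₀ , l₀≤l , w₀ , short = l₀ , ≤-trans l₀≤l l≤d , shortest-stays-inside sa sb w₀ short

short-side : ∀ a b k → a + b ≤ k + k → suc k ≤ b → suc a ≤ k
short-side a b k a+b≤2k k<b = +-cancelʳ-≤ k (suc a) k
  (≤-trans (≤-reflexive (sym (+-suc a k))) (≤-trans (+-monoʳ-≤ a k<b) a+b≤2k))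

module Radius {m : ℕ} {R : NodeRel m} (symR : ∀ {x y} → R x y → R y x) (noBypass : NoBypass R)
  (R? : ∀ a b → Dec (R a b)) {S : Fin m → Set}
  (connected : ∀ a b → S a → S b → Σ ℕ (Walk R a b)) (closed : ∀ {a b} → R a b → S b)
  (k : ℕ) where

  -- Take one step c → y along a shortest walk to t while d(c,t) > k.  Any z with
  -- d(c,z) ≤ k and d(z,t) ≤ 2k satisfies d(y,z) ≤ k: either the walk c ⇝ z passes y,
  -- or the walk z ⇝ t passes c (then d(z,c) < k), or together with y ⇝ t they
  -- form a detour around the edge c–y.
  step-keeps-near : ∀ {c y t z D} → k ≤ D → R c y → Walk R y t D → Shortest R c t (suc D) →
    DistLe R c z k → DistLe R z t (k + k) → DistLe R y z k
  step-keeps-near {c} {y} k≤D r yt short (l , l≤k , cz) (q , q≤2k , zt) with avoids-or-visits y cz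
  ... | inj₂ (l₁ , l₂ , refl , _ , yz) = l₂ , ≤-trans (m≤n+m l₂ l₁) l≤k , yz
  ... | inj₁ (_ , cz-avoiding-y) with avoids-or-visits c zt
  ...   | inj₂ (q₁ , q₂ , refl , zc , ct) =
          suc q₁ , short-side q₁ q₂ k q≤2k (≤-trans (s≤s k≤D) (short ct)) ,
          step (symR r) (reverseʷ symR zc)
  ...   | inj₁ (_ , zt-avoiding-c) = ⊥-elim (no-detour noBypass r
          (tail-avoids-head short yt ++ʷ reverseʷ (Avoiding-sym symR) zt-avoiding-c)
          (reverseʷ (Avoiding-sym symR) cz-avoiding-y))

  -- Walk from c along a shortest walk towards t until within k of t.  Every node of P
  -- (all within 2k of t) that was within k of c stays within k of the stopping point.
  approach : (P : Fin m → Set) (t : Fin m) → (∀ {z} → P z → DistLe R z t (k + k)) →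
    ∀ {c D} → S c → Walk R c t D → Shortest R c t D → (∀ {z} → P z → DistLe R c z k) →
    Σ (Fin m) λ c' → S c' × DistLe R c' t k × (∀ {z} → P z → DistLe R c' z k)
  approach P t near-t {c} {zero} sc w _ near-c = c , sc , (0 , z≤n , w) , near-c
  approach P t near-t {c} {suc D} sc (step r rest) short near-c with suc D ≤? k
  ... | yes D<k = c , sc , (suc D , D<k , step r rest) , near-c
  ... | no D≮k = approach P t near-t (closed r) rest (shortest-tail r short)
        (λ pz → step-keeps-near (≤-pred (≰⇒> D≮k)) r rest short (near-c pz) (near-t pz))

  radius-from-diameter : ∀ {s₀} → S s₀ → (zs : List (Fin m)) → (∀ {z} → z ∈ zs → S z) →
    (∀ {z z'} → z ∈ zs → z' ∈ zs → DistLe R z z' (k + k)) →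
    Σ (Fin m) λ c → S c × (∀ {z} → z ∈ zs → DistLe R c z k)
  radius-from-diameter s₀∈S [] _ _ = _ , s₀∈S , λ ()
  radius-from-diameter s₀∈S (x ∷ zs) zs⊆S diameter
    with radius-from-diameter s₀∈S zs (λ z∈ → zs⊆S (there z∈))
           (λ z∈ z'∈ → diameter (there z∈) (there z'∈))
  ... | c , c∈S , near with shortest R? (proj₂ (connected c x c∈S (zs⊆S (here refl))))
  ...   | _ , _ , cx , short
        with approach (_∈ zs) x (λ z∈ → diameter (there z∈) (here refl)) c∈S cx short near
  ...     | c' , c'∈S , near-x , near' = c' , c'∈S , λ { (here refl) → near-x ; (there z∈) → near' z∈ }

module _ {n m : ℕ} (T : Tree m) (ι : Fin n → Fin m) {K : Fin n → Set} {S : Fin m → Set}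
         (steiner : IsSteinerSubtree T ι K S) where

  private
    A : NodeRel m
    A = Tree.Adj T

  -- If every node of ι(K) is within distance r of c in T[S], then so is every node of S:
  -- the nodes of S within r of c form a subtree containing ι(K), which by minimality
  -- of the Steiner subtree contains S.
  within-ball : ∀ {c r} → (∀ x → K x → DistLe (Induced A S) c (ι x) r) → EccLe T S c r
  within-ball {c} {r} near v sv = proj₂ (proj₂ steiner Ball ball-subtree v sv)
    where
    Ball : Fin m → Set
    Ball a = S a × DistLe (Induced A S) c a r

    stays-in-ball : ∀ {p a} j {l} → j + l ≤ r →
      Walk (Induced A S) c p j → Walk (Induced A S) p a l → Walk (Induced A Ball) p a l
    stays-in-ball j _ _ here = here
    stays-in-ball j {suc l} room cp (step e rest) =
      step ((proj₁ e , j , ≤-trans (m≤m+n j (suc l)) room , cp) ,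
            (proj₁ (proj₂ e) , suc j , ≤-trans (s≤s (m≤m+n j l)) room' , cp ▷ e) , proj₂ (proj₂ e))
           (stays-in-ball (suc j) room' (cp ▷ e) rest)
      where
      room' : suc j + l ≤ r
      room' = subst (_≤ r) (+-suc j l) room

    from-centre : ∀ {a} → DistLe (Induced A S) c a r → Σ ℕ (Walk (Induced A Ball) c a)
    from-centre (l , l≤r , w) = l , stays-in-ball 0 l≤r here w

    ball-connected : ∀ a b → Ball a → Ball b → Σ ℕ (Walk (Induced A Ball) a b)
    ball-connected a b (_ , ca) (_ , cb) with from-centre ca | from-centre cb
    ... | _ , ca' | _ , cb' = _ , reverseʷ (Induced-sym {S = Ball} (Tree.sym T)) ca' ++ʷ cb'

    ball-subtree : IsSubtreeContaining T ι K Ball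
    ball-subtree = (λ x kx → proj₁ (proj₁ steiner) x kx , near x kx) , ball-connected

double : ∀ k → k + k ≡ 2 * k
double k = cong (k +_) (sym (+-identityʳ k))

module SteinerRoot {n m : ℕ} (k : ℕ) (G : Graph n) (T : Tree m) (ι : Fin n → Fin m)
  (root : ∀ u v → u ≢ v → (Graph.Adj G u v ⇔ DistLe (Tree.Adj T) (ι u) (ι v) (2 * k)))
  (A? : ∀ a b → Dec (Tree.Adj T a b)) where

  private
    A : NodeRel m
    A = Tree.Adj T

  clique-distance : ∀ {K} → IsClique G K → ∀ {u v} → K u → K v → DistLe A (ι u) (ι v) (k + k)
  clique-distance clique {u} {v} ku kv with u ≟ᶠ v
  ... | yes refl = 0 , z≤n , here
  ... | no u≢v = subst (DistLe A (ι u) (ι v)) (sym (double k))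
                   (Equivalence.to (root u v u≢v) (clique u v ku kv u≢v))

  -- The Steiner subtree of a clique has a node of eccentricity ≤ k: its terminals have
  -- pairwise distance ≤ 2k in T[S] (subtrees are isometric), so some node is within k
  -- of all of them, and then within k of all of S.
  clique-radius : ∀ {K S} → IsClique G K → (∀ x → Dec (K x)) →
    IsSteinerSubtree T ι K S → (∀ a → Dec (S a)) →
    ∀ {s₀} → S s₀ → Σ (Fin m) λ c → S c × EccLe T S c k
  clique-radius {K} {S} clique K? steiner S? s₀∈S =
    let (c , c∈S , near) = radius-from-diameter s₀∈S terminals terminal-in-S diameter
    in c , c∈S , within-ball T ι steiner
         (λ x kx → near (∈-map∘filter⁺ ι K? {xs = allFin n} (x , ∈-allFin x , refl , kx)))
    where
    noBypass : NoBypass A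
    noBypass = trees-have-no-bypass T
    connected : InducesConnected A S
    connected = proj₂ (proj₁ steiner)
    open Radius (Induced-sym {S = S} (Tree.sym T)) (no-bypass-⊆ (λ e → proj₂ (proj₂ e)) noBypass)
                (λ a b → S? a ×-dec (S? b ×-dec A? a b)) connected (λ e → proj₁ (proj₂ e)) k

    terminals : List (Fin m)
    terminals = map ι (filter K? (allFin n))

    terminal-in-S : ∀ {z} → z ∈ terminals → S z
    terminal-in-S z∈ with ∈-map∘filter⁻ ι K? {xs = allFin n} z∈
    ... | x , _ , refl , kx = proj₁ (proj₁ steiner) x kx

    diameter : ∀ {z z'} → z ∈ terminals → z' ∈ terminals → DistLe (Induced A S) z z' (k + k)
    diameter z∈ z'∈
      with ∈-map∘filter⁻ ι K? {xs = allFin n} z∈ | ∈-map∘filter⁻ ι K? {xs = allFin n} z'∈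
    ... | x , _ , refl , kx | x' , _ , refl , kx' =
      induced-distance noBypass S? connected A? (proj₁ (proj₁ steiner) x kx) (proj₁ (proj₁ steiner) x' kx')
        (clique-distance clique kx kx')

  centre-eccentricity : ∀ {K S c} → IsClique G K → (∀ x → Dec (K x)) →
    IsSteinerSubtree T ι K S → (∀ a → Dec (S a)) → InCenter T S c → EccLe T S c k
  centre-eccentricity clique K? steiner S? (c∈S , central) =
    let (c' , c'∈S , ecc) = clique-radius clique K? steiner S? c∈S in central c' c'∈S k ecc

  -- A node within k of all of ι(K) in T⟨K⟩ and of all of ι(L) in T⟨L⟩ joins every
  -- member of K to every member of L, since they are within k + k through it.
  shared-centre-joins : ∀ {K L SK SL c} → IsSteinerSubtree T ι K SK → IsSteinerSubtree T ι L SL →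
    EccLe T SK c k → EccLe T SL c k → ∀ u v → K u → L v → u ≢ v → Graph.Adj G u v
  shared-centre-joins steinerK steinerL eccK eccL u v ku lv u≢v =
    Equivalence.from (root u v u≢v) (subst (DistLe A (ι u) (ι v)) (double k)
      (meet (Tree.sym T) (forget-induced (eccK (ι u) (proj₁ (proj₁ steinerK) u ku)))
                         (forget-induced (eccL (ι v) (proj₁ (proj₁ steinerL) v lv)))))

union-clique : ∀ {n} (G : Graph n) {K L : Fin n → Set} → IsClique G K → IsClique G L →
  (∀ u v → K u → L v → u ≢ v → Graph.Adj G u v) → IsClique G (λ x → K x ⊎ L x)
union-clique G cliqueK cliqueL cross u v (inj₁ ku) (inj₁ kv) = cliqueK u v ku kv
union-clique G cliqueK cliqueL cross u v (inj₂ lu) (inj₂ lv) = cliqueL u v lu lv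
union-clique G cliqueK cliqueL cross u v (inj₁ ku) (inj₂ lv) = cross u v ku lv
union-clique G cliqueK cliqueL cross u v (inj₂ lu) (inj₁ kv) u≢v =
  Graph.sym G (cross v u kv lu (λ v≡u → u≢v (sym v≡u)))

-- Two maximal cliques whose union is a clique are equal: both are contained in it.
maximal-cliques-coincide : ∀ {n} (G : Graph n) {K L : Fin n → Set} →
  IsMaximalClique G K → IsMaximalClique G L → IsClique G (λ x → K x ⊎ L x) → ∀ x → K x ⇔ L x
maximal-cliques-coincide G (_ , maximalK) (_ , maximalL) union x =
  mk⇔ (λ kx → maximalL _ union (λ _ → inj₂) x (inj₁ kx))
      (λ lx → maximalK _ union (λ _ → inj₁) x (inj₂ lx))

¬¬-finite-∀ : ∀ {m} (Q : Fin m → Set) → (∀ x → ¬ ¬ Q x) → ¬ ¬ (∀ x → Q x)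
¬¬-finite-∀ {zero} Q _ ¬∀ = ¬∀ (λ ())
¬¬-finite-∀ {suc m} Q ¬¬Q ¬∀ = ¬¬Q fzero λ q₀ →
  ¬¬-finite-∀ (λ x → Q (fsuc x)) (λ x → ¬¬Q (fsuc x)) λ qs → ¬∀ λ { fzero → q₀ ; (fsuc x) → qs x }

-- When proving a negation we may assume predicates and relations on Fin m decidable.
¬¬-decidable : ∀ {m} (P : Fin m → Set) → ¬ ¬ (∀ x → Dec (P x))
¬¬-decidable P = ¬¬-finite-∀ (λ x → Dec (P x)) (λ _ → ¬¬-excluded-middle)

¬¬-decidable₂ : ∀ {m} (R : NodeRel m) → ¬ ¬ (∀ a b → Dec (R a b))
¬¬-decidable₂ R = ¬¬-finite-∀ (λ a → ∀ b → Dec (R a b)) (λ a → ¬¬-decidable (R a))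

lemma3p7 : (k : ℕ) → 1 ≤ k → {n m : ℕ} (G : Graph n) (T : Tree m) (ι : Fin n → Fin m) →
    IsSteinerRoot k G T ι →
    (Ki Kj : Fin n → Set) → IsMaximalClique G Ki → IsMaximalClique G Kj →
    ¬ (∀ (x : Fin n) → Ki x ⇔ Kj x) →
    (Si Sj : Fin m → Set) → IsSteinerSubtree T ι Ki Si → IsSteinerSubtree T ι Kj Sj →
    ∀ (c : Fin m) → ¬ (InCenter T Si c × InCenter T Sj c)
lemma3p7 k _ G T ι (_ , root) Ki Kj maximalI maximalJ Ki≉Kj Si Sj steinerI steinerJ c (centreI , centreJ) =
  ¬¬-decidable₂ (Tree.Adj T) λ A? → ¬¬-decidable Ki λ Ki? → ¬¬-decidable Kj λ Kj? →
  ¬¬-decidable Si λ Si? → ¬¬-decidable Sj λ Sj? →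
  let open SteinerRoot k G T ι root A?
      eccI = centre-eccentricity (proj₁ maximalI) Ki? steinerI Si? centreI
      eccJ = centre-eccentricity (proj₁ maximalJ) Kj? steinerJ Sj? centreJ
      union = union-clique G (proj₁ maximalI) (proj₁ maximalJ)
                (shared-centre-joins steinerI steinerJ eccI eccJ)
  in Ki≉Kj (maximal-cliques-coincide G maximalI maximalJ union)
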